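{- The Set-Fmla logic $\mathcal{PP}^{\Rightarrow_H}_{\le}$ has the extension interpolation property (EIP), but has neither the Craig interpolation property (CIP) nor the Maehara interpolation property (MIP).
   Context: $\mathbf{PP}_6^{\Rightarrow_H}$ is the algebra in signature $\Sigma=\{\land,\lor,\Rightarrow,{\sim},\circ,\bot,\top\}$ with carrier $\mathcal V_6=\{\hat{\mathbf f},\mathbf f,\mathbf n,\mathbf b,\mathbf t,\hat{\mathbf t}\}$ ordered by $\hat{\mathbf f}<\mathbf f<\mathbf n<\mathbf t<\hat{\mathbf t}$, $\mathbf f<\mathbf b<\mathbf t$, $\mathbf n,\mathbf b$ incomparable; $\land,\lor$ meet and join, $\bot=\hat{\mathbf f}$, $\top=\hat{\mathbf t}$, ${\sim}$ swaps $\mathbf f\leftrightarrow\mathbf t$, $\hat{\mathbf f}\leftrightarrow\hat{\mathbf t}$ and fixes $\mathbf n,\mathbf b$; $\circ a=\hat{\mathbf t}$ if $a\in\{\hat{\mathbf f},\hat{\mathbf t}\}$, else $\hat{\mathbf f}$; $a\Rightarrow b=\max\{c: a\land c\le b\}$. $\mathcal{PP}^{\Rightarrow_H}_{\le}$: $\Phi\vdash\psi$ iff for some finite $\Phi'\subseteq\Phi$ the inequality $\bigwedge\Phi'\le\psi$ ($\bigwedge\varnothing=\top$) holds in all members of the variety generated by $\mathbf{PP}_6^{\Rightarrow_H}$ under all assignments. For a set $S$ of variables, $L(S)$ denotes the set of $\Sigma$-formulas whose variables lie in $S$; $\mathsf{props}(\Gamma)$ is the set of variables occurring in $\Gamma$.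 A Set-Fmla logic $\vdash$ has: (EIP) if $\Phi\cup\Psi\vdash\varphi$ implies there is $\Pi\subseteq L(\mathsf{props}(\Psi\cup\{\varphi\}))$ with $\Phi\vdash\pi$ for all $\pi\in\Pi$ and $\Pi\cup\Psi\vdash\varphi$; (CIP) if, whenever $\mathsf{props}(\Phi)\cap\mathsf{props}(\varphi)\ne\varnothing$, $\Phi\vdash\varphi$ implies there is $\Pi\subseteq L(\mathsf{props}(\Phi)\cap\mathsf{props}(\varphi))$ with $\Phi\vdash\pi$ for all $\pi\in\Pi$ and $\Pi\vdash\varphi$; (MIP) if, whenever $\mathsf{props}(\Phi)\cap\mathsf{props}(\Psi\cup\{\varphi\})\ne\varnothing$, $\Phi\cup\Psi\vdash\varphi$ implies there is $\Pi\subseteq L(\mathsf{props}(\Phi)\cap\mathsf{props}(\Psi\cup\{\varphi\}))$ with $\Phi\vdash\pi$ for all $\pi\in\Pi$ and $\Pi\cup\Psi\vdash\varphi$. -}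

module Defs where

open import Level using (0ℓ)
open import Data.Nat using (ℕ)
open import Data.Bool using (Bool; true; false; if_then_else_; _∧_)
open import Data.List using (List; []; _∷_; foldr)
open import Data.List.Relation.Unary.All using (All)
open import Data.Product using (Σ; ∃; _×_; _,_)
open import Data.Sum using (_⊎_)
open import Relation.Binary.Core using (Rel)
open import Relation.Binary.Structures using (IsEquivalence)
open import Relation.Binary.PropositionalEquality using (_≡_; isEquivalence; cong; cong₂)
open import Relation.Unary using (Pred; _∪_; _∩_; _⊆_)

data V6 : Set where
  f̂ f n b t t̂ : V6

-- the partial order  f̂ < f < n < t < t̂ ,  f < b < t ,  n , b incomparable
_≤ᵇ_ : V6 → V6 → Bool
f̂ ≤ᵇ _  = true
f  ≤ᵇ f̂ = false
f  ≤ᵇ _  = true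
n  ≤ᵇ n  = true
n  ≤ᵇ t  = true
n  ≤ᵇ t̂  = true
n  ≤ᵇ _  = false
b  ≤ᵇ b  = true
b  ≤ᵇ t  = true
b  ≤ᵇ t̂  = true
b  ≤ᵇ _  = false
t  ≤ᵇ t  = true
t  ≤ᵇ t̂  = true
t  ≤ᵇ _  = false
t̂  ≤ᵇ t̂  = true
t̂  ≤ᵇ _  = false

-- meet and join (the only incomparable pair is n , b with meet f and join t)
meet6 : V6 → V6 → V6
meet6 n b = f
meet6 b n = f
meet6 x y = if x ≤ᵇ y then x else y

join6 : V6 → V6 → V6
join6 n b = t
join6 b n = t
join6 x y = if x ≤ᵇ y then y else x

allV6 : List V6
allV6 = f̂ ∷ f ∷ n ∷ b ∷ t ∷ t̂ ∷ []

-- a ⇒ b = max { c : a ∧ c ≤ b }, computed as the join of all such c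
-- (the lattice is finite and distributive, so this join is the maximum)
imp6 : V6 → V6 → V6
imp6 x y = foldr (λ c acc → if meet6 x c ≤ᵇ y then join6 c acc else acc) f̂ allV6

neg6 : V6 → V6
neg6 f̂ = t̂
neg6 f  = t
neg6 n  = n
neg6 b  = b
neg6 t  = f
neg6 t̂  = f̂

circ6 : V6 → V6
circ6 f̂ = t̂
circ6 t̂ = t̂
circ6 _  = f̂

data Fm : Set where
  var  : ℕ → Fm
  _∧̇_  : Fm → Fm → Fm
  _∨̇_  : Fm → Fm → Fm
  _⇒̇_  : Fm → Fm → Fm
  ∼̇_   : Fm → Fm
  ∘̇_   : Fm → Fm
  ⊥̇    : Fm
  ⊤̇    : Fm

data Occurs (p : ℕ) : Fm → Set where
  o-var : Occurs p (var p)
  o-∧l  : ∀ {φ ψ} → Occurs p φ → Occurs p (φ ∧̇ ψ)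
  o-∧r  : ∀ {φ ψ} → Occurs p ψ → Occurs p (φ ∧̇ ψ)
  o-∨l  : ∀ {φ ψ} → Occurs p φ → Occurs p (φ ∨̇ ψ)
  o-∨r  : ∀ {φ ψ} → Occurs p ψ → Occurs p (φ ∨̇ ψ)
  o-⇒l  : ∀ {φ ψ} → Occurs p φ → Occurs p (φ ⇒̇ ψ)
  o-⇒r  : ∀ {φ ψ} → Occurs p ψ → Occurs p (φ ⇒̇ ψ)
  o-∼   : ∀ {φ} → Occurs p φ → Occurs p (∼̇ φ)
  o-∘   : ∀ {φ} → Occurs p φ → Occurs p (∘̇ φ)

props : Pred Fm 0ℓ → Pred ℕ 0ℓ
props Γ p = ∃ λ φ → Γ φ × Occurs p φ

propsF : Fm → Pred ℕ 0ℓ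
propsF φ p = Occurs p φ

L : Pred ℕ 0ℓ → Pred Fm 0ℓ
L S φ = ∀ p → Occurs p φ → S p

⟦_⟧ : Fm → Pred Fm 0ℓ
⟦ φ ⟧ ψ = ψ ≡ φ

Meets : Pred ℕ 0ℓ → Pred ℕ 0ℓ → Set
Meets S T = ∃ λ p → S p × T p

record SigAlg : Set₁ where
  field
    Carrier : Set
    _≈_     : Rel Carrier 0ℓ
    isEquiv : IsEquivalence _≈_
    _⊓_ _⊔_ _⟶_ : Carrier → Carrier → Carrier
    ∼ᴬ ∘ᴬ   : Carrier → Carrier
    ⊥ᴬ ⊤ᴬ   : Carrier
    ⊓-cong  : ∀ {x x' y y'} → x ≈ x' → y ≈ y' → (x ⊓ y) ≈ (x' ⊓ y')
    ⊔-cong  : ∀ {x x' y y'} → x ≈ x' → y ≈ y' → (x ⊔ y) ≈ (x' ⊔ y')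
    ⟶-cong  : ∀ {x x' y y'} → x ≈ x' → y ≈ y' → (x ⟶ y) ≈ (x' ⟶ y')
    ∼-cong  : ∀ {x x'} → x ≈ x' → ∼ᴬ x ≈ ∼ᴬ x'
    ∘-cong  : ∀ {x x'} → x ≈ x' → ∘ᴬ x ≈ ∘ᴬ x'

open SigAlg public

PP6 : SigAlg
PP6 = record
  { Carrier = V6 ; _≈_ = _≡_ ; isEquiv = isEquivalence
  ; _⊓_ = meet6 ; _⊔_ = join6 ; _⟶_ = imp6 ; ∼ᴬ = neg6 ; ∘ᴬ = circ6
  ; ⊥ᴬ = f̂ ; ⊤ᴬ = t̂
  ; ⊓-cong = cong₂ meet6 ; ⊔-cong = cong₂ join6 ; ⟶-cong = cong₂ imp6
  ; ∼-cong = cong neg6 ; ∘-cong = cong circ6 }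

eval : (A : SigAlg) → (ℕ → Carrier A) → Fm → Carrier A
eval A v (var p)   = v p
eval A v (φ ∧̇ ψ)   = _⊓_ A (eval A v φ) (eval A v ψ)
eval A v (φ ∨̇ ψ)   = _⊔_ A (eval A v φ) (eval A v ψ)
eval A v (φ ⇒̇ ψ)   = _⟶_ A (eval A v φ) (eval A v ψ)
eval A v (∼̇ φ)     = ∼ᴬ A (eval A v φ)
eval A v (∘̇ φ)     = ∘ᴬ A (eval A v φ)
eval A v ⊥̇         = ⊥ᴬ A
eval A v ⊤̇         = ⊤ᴬ A

ValidEq : SigAlg → Fm → Fm → Set
ValidEq A s₁ s₂ = ∀ (v : ℕ → Carrier A) → _≈_ A (eval A v s₁) (eval A v s₂)

-- A belongs to the variety generated by PP6 (= Mod(Eq(PP6)), Birkhoff)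
InVariety : SigAlg → Set
InVariety A = ∀ s₁ s₂ → ValidEq PP6 s₁ s₂ → ValidEq A s₁ s₂

⋀ : List Fm → Fm
⋀ []       = ⊤̇
⋀ (φ ∷ φs) = φ ∧̇ ⋀ φs

HoldsLeq : (A : SigAlg) → (ℕ → Carrier A) → Fm → Fm → Set
HoldsLeq A v s₁ s₂ = _≈_ A (eval A v (s₁ ∧̇ s₂)) (eval A v s₁)

_⊢_ : Pred Fm 0ℓ → Fm → Set₁
Φ ⊢ ψ = Σ (List Fm) λ Φ' → All Φ Φ' ×
          (∀ (A : SigAlg) → InVariety A → ∀ (v : ℕ → Carrier A) → HoldsLeq A v (⋀ Φ') ψ)

Logic : Set₂
Logic = Pred Fm 0ℓ → Fm → Set₁

EIP : Logic → Set₁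
EIP _⊩_ = ∀ (Φ Ψ : Pred Fm 0ℓ) (φ : Fm) → (Φ ∪ Ψ) ⊩ φ →
  Σ (Pred Fm 0ℓ) λ Π → Π ⊆ L (props (Ψ ∪ ⟦ φ ⟧)) ×
    (∀ π → Π π → Φ ⊩ π) × ((Π ∪ Ψ) ⊩ φ)

CIP : Logic → Set₁
CIP _⊩_ = ∀ (Φ : Pred Fm 0ℓ) (φ : Fm) → Meets (props Φ) (propsF φ) → Φ ⊩ φ →
  Σ (Pred Fm 0ℓ) λ Π → Π ⊆ L (props Φ ∩ propsF φ) ×
    (∀ π → Π π → Φ ⊩ π) × (Π ⊩ φ)

MIP : Logic → Set₁
MIP _⊩_ = ∀ (Φ Ψ : Pred Fm 0ℓ) (φ : Fm) → Meets (props Φ) (props (Ψ ∪ ⟦ φ ⟧)) → (Φ ∪ Ψ) ⊩ φ →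
  Σ (Pred Fm 0ℓ) λ Π → Π ⊆ L (props Φ ∩ props (Ψ ∪ ⟦ φ ⟧)) ×
    (∀ π → Π π → Φ ⊩ π) × ((Π ∪ Ψ) ⊩ φ)

-- EIP: if premises P ⊆ Φ and Q ⊆ Ψ give φ, Heyting residuation turns ⋀P ∧ ⋀Q ≤ φ into
-- ⋀P ≤ ⋀Q ⇒ φ, and modus ponens recovers φ from ⋀Q ⇒ φ together with Q.
-- CIP fails on  p ∧ (q ∧ ∼q) ⊢ p ∧ (r ∨ (r ⇒ ∼r)),  valid since q ∧ ∼q never exceeds t and
-- r ∨ (r ⇒ ∼r) is never below t.  Under p = t̂, q = n, r = t the premise has value n and the
-- conclusion value t, while every formula in p alone takes a value in the subalgebra {f̂, t̂};
-- such a formula above n is t̂, so no set of them entails the conclusion.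
-- MIP with Ψ = ∅ is CIP.
module Submission where

open import Defs
open import Level using (0ℓ)
open import Function using (id; _∘_)
open import Data.Empty using (⊥; ⊥-elim)
open import Data.Fin as Fin using (Fin)
open import Data.List using (List; []; _∷_; lookup)
open import Data.List.Membership.Propositional using (_∈_)
open import Data.List.Relation.Unary.Any using (here; there; index)
open import Data.List.Relation.Unary.Any.Properties using (lookup-index)
open import Data.List.Relation.Unary.All as All using (All; []; _∷_; all?)
open import Data.Nat using (ℕ)
open import Data.Product using (_×_; _,_)
open import Data.Sum using (inj₁; inj₂; [_,_])
open import Relation.Binary.Definitions using (DecidableEquality)
open import Relation.Binary.PropositionalEquality
  using (_≡_; refl; sym; trans; cong; subst; module ≡-Reasoning)
open import Relation.Nullary using (Dec; ¬_)
open import Relation.Nullary.Decidable using (map′; from-yes; _→-dec_)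
open import Relation.Unary using (Pred; _∪_; _∩_; _⊆_)

x∈allV6 : ∀ x → x ∈ allV6
x∈allV6 f̂ = here refl
x∈allV6 f = there (here refl)
x∈allV6 n = there (there (here refl))
x∈allV6 b = there (there (there (here refl)))
x∈allV6 t = there (there (there (there (here refl))))
x∈allV6 t̂ = there (there (there (there (there (here refl)))))

position : V6 → Fin 6
position = index ∘ x∈allV6

position-injective : ∀ {x y} → position x ≡ position y → x ≡ y
position-injective {x} {y} eq =
  trans (lookup-index (x∈allV6 x)) (trans (cong (lookup allV6) eq) (sym (lookup-index (x∈allV6 y))))

_≟_ : DecidableEquality V6
x ≟ y = map′ position-injective (cong position) (position x Fin.≟ position y)

∀? : {P : V6 → Set} → (∀ x → Dec (P x)) → Dec (∀ x → P x)
∀? P? = map′ (λ all x → All.lookup all (x∈allV6 x)) (λ ∀P → All.tabulate λ {x} _ → ∀P x) (all? P? allV6)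

_≤₆_ : V6 → V6 → Set
x ≤₆ y = meet6 x y ≡ x

meet6-assoc : ∀ x y z → meet6 (meet6 x y) z ≡ meet6 x (meet6 y z)
meet6-assoc = from-yes (∀? λ x → ∀? λ y → ∀? λ z → meet6 (meet6 x y) z ≟ meet6 x (meet6 y z))

meet6-comm : ∀ x y → meet6 x y ≡ meet6 y x
meet6-comm = from-yes (∀? λ x → ∀? λ y → meet6 x y ≟ meet6 y x)

meet6-identityʳ : ∀ x → meet6 x t̂ ≡ x
meet6-identityʳ = from-yes (∀? λ x → meet6 x t̂ ≟ x)

imp6-residual : ∀ x y z → meet6 x y ≤₆ z → x ≤₆ imp6 y z
imp6-residual = from-yes (∀? λ x → ∀? λ y → ∀? λ z →
  (meet6 (meet6 x y) z ≟ meet6 x y) →-dec (meet6 x (imp6 y z) ≟ x))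

imp6-modusPonens : ∀ y z → meet6 (imp6 y z) y ≤₆ z
imp6-modusPonens = from-yes (∀? λ y → ∀? λ z → meet6 (meet6 (imp6 y z) y) z ≟ meet6 (imp6 y z) y)

meet6-leftComm : ∀ x y z → meet6 x (meet6 y z) ≡ meet6 y (meet6 x z)
meet6-leftComm x y z = begin
  meet6 x (meet6 y z)  ≡⟨ sym (meet6-assoc x y z) ⟩
  meet6 (meet6 x y) z  ≡⟨ cong (λ w → meet6 w z) (meet6-comm x y) ⟩
  meet6 (meet6 y x) z  ≡⟨ meet6-assoc y x z ⟩
  meet6 y (meet6 x z)  ∎
  where open ≡-Reasoning

≤₆-trans : ∀ {x y z} → x ≤₆ y → y ≤₆ z → x ≤₆ z
≤₆-trans {x} {y} {z} x≤y y≤z = begin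
  meet6 x z            ≡⟨ cong (λ w → meet6 w z) (sym x≤y) ⟩
  meet6 (meet6 x y) z  ≡⟨ meet6-assoc x y z ⟩
  meet6 x (meet6 y z)  ≡⟨ cong (meet6 x) y≤z ⟩
  meet6 x y            ≡⟨ x≤y ⟩
  x                    ∎
  where open ≡-Reasoning

≤₆-meet : ∀ {x y z} → x ≤₆ y → x ≤₆ z → x ≤₆ meet6 y z
≤₆-meet {x} {y} {z} x≤y x≤z = begin
  meet6 x (meet6 y z)  ≡⟨ sym (meet6-assoc x y z) ⟩
  meet6 (meet6 x y) z  ≡⟨ cong (λ w → meet6 w z) x≤y ⟩
  meet6 x z            ≡⟨ x≤z ⟩
  x                    ∎
  where open ≡-Reasoning

⟦_⟧₆ : Fm → (ℕ → V6) → V6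
⟦ φ ⟧₆ v = eval PP6 v φ

⋀-greatest : ∀ {x} v Δ → All (λ ψ → x ≤₆ ⟦ ψ ⟧₆ v) Δ → x ≤₆ ⟦ ⋀ Δ ⟧₆ v
⋀-greatest {x} v []      []            = meet6-identityʳ x
⋀-greatest     v (_ ∷ Δ) (x≤ψ ∷ x≤Δ) = ≤₆-meet x≤ψ (⋀-greatest v Δ x≤Δ)

PP6∈variety : InVariety PP6
PP6∈variety _ _ valid = valid

PP6-valid⇒⊢ : ∀ {Φ ψ} Δ → All Φ Δ → (∀ v → ⟦ ⋀ Δ ⟧₆ v ≤₆ ⟦ ψ ⟧₆ v) → Φ ⊢ ψ
PP6-valid⇒⊢ {ψ = ψ} Δ Δ⊆Φ valid = Δ , Δ⊆Φ , λ A A∈V → A∈V (⋀ Δ ∧̇ ψ) (⋀ Δ) valid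

record Partition (Φ Ψ : Pred Fm 0ℓ) (Δ : List Fm) : Set where
  field
    fromΦ fromΨ : List Fm
    fromΦ⊆Φ : All Φ fromΦ
    fromΨ⊆Ψ : All Ψ fromΨ
    ⋀-split : ∀ v → ⟦ ⋀ Δ ⟧₆ v ≡ meet6 (⟦ ⋀ fromΦ ⟧₆ v) (⟦ ⋀ fromΨ ⟧₆ v)

partition : ∀ {Φ Ψ} Δ → All (Φ ∪ Ψ) Δ → Partition Φ Ψ Δ
partition [] [] = record { fromΦ = [] ; fromΨ = [] ; fromΦ⊆Φ = [] ; fromΨ⊆Ψ = [] ; ⋀-split = λ _ → refl }
partition (ψ ∷ Δ) (inj₁ ψ∈Φ ∷ Δ⊆Φ∪Ψ) = record
  { fromΦ = ψ ∷ fromΦ ; fromΨ = fromΨ ; fromΦ⊆Φ = ψ∈Φ ∷ fromΦ⊆Φ ; fromΨ⊆Ψ = fromΨ⊆Ψ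
  ; ⋀-split = λ v → trans (cong (meet6 (⟦ ψ ⟧₆ v)) (⋀-split v))
                         (sym (meet6-assoc (⟦ ψ ⟧₆ v) (⟦ ⋀ fromΦ ⟧₆ v) (⟦ ⋀ fromΨ ⟧₆ v))) }
  where open Partition (partition Δ Δ⊆Φ∪Ψ)
partition (ψ ∷ Δ) (inj₂ ψ∈Ψ ∷ Δ⊆Φ∪Ψ) = record
  { fromΦ = fromΦ ; fromΨ = ψ ∷ fromΨ ; fromΦ⊆Φ = fromΦ⊆Φ ; fromΨ⊆Ψ = ψ∈Ψ ∷ fromΨ⊆Ψ
  ; ⋀-split = λ v → trans (cong (meet6 (⟦ ψ ⟧₆ v)) (⋀-split v))
                         (meet6-leftComm (⟦ ψ ⟧₆ v) (⟦ ⋀ fromΦ ⟧₆ v) (⟦ ⋀ fromΨ ⟧₆ v)) }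
  where open Partition (partition Δ Δ⊆Φ∪Ψ)

props-⋀ : ∀ {Ψ p} Δ → All Ψ Δ → Occurs p (⋀ Δ) → props Ψ p
props-⋀ (ψ ∷ _) (ψ∈Ψ ∷ _)  (o-∧l p∈ψ) = ψ , ψ∈Ψ , p∈ψ
props-⋀ (_ ∷ Δ) (_ ∷ Δ⊆Ψ) (o-∧r p∈Δ) = props-⋀ Δ Δ⊆Ψ p∈Δ

eip-⊢ : EIP _⊢_
eip-⊢ Φ Ψ φ (Δ , Δ⊆Φ∪Ψ , Δ≤φ) = ⟦ ⋀ fromΨ ⇒̇ φ ⟧ , interpolant-vars , Φ⊢interpolant , interpolant,Ψ⊢φ
  where
    open Partition (partition Δ Δ⊆Φ∪Ψ)

    interpolant-vars : ⟦ ⋀ fromΨ ⇒̇ φ ⟧ ⊆ L (props (Ψ ∪ ⟦ φ ⟧))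
    interpolant-vars refl p (o-⇒l p∈Q) with props-⋀ fromΨ fromΨ⊆Ψ p∈Q
    ... | ψ , ψ∈Ψ , p∈ψ = ψ , inj₁ ψ∈Ψ , p∈ψ
    interpolant-vars refl p (o-⇒r p∈φ) = φ , inj₂ refl , p∈φ

    Φ⊢interpolant : ∀ π → ⟦ ⋀ fromΨ ⇒̇ φ ⟧ π → Φ ⊢ π
    Φ⊢interpolant _ refl = PP6-valid⇒⊢ {ψ = ⋀ fromΨ ⇒̇ φ} fromΦ fromΦ⊆Φ λ v →
      imp6-residual (⟦ ⋀ fromΦ ⟧₆ v) (⟦ ⋀ fromΨ ⟧₆ v) (⟦ φ ⟧₆ v)
        (subst (_≤₆ ⟦ φ ⟧₆ v) (⋀-split v) (Δ≤φ PP6 PP6∈variety v))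

    interpolant,Ψ⊢φ : (⟦ ⋀ fromΨ ⇒̇ φ ⟧ ∪ Ψ) ⊢ φ
    interpolant,Ψ⊢φ = PP6-valid⇒⊢ {ψ = φ} ((⋀ fromΨ ⇒̇ φ) ∷ fromΨ) (inj₁ refl ∷ All.map inj₂ fromΨ⊆Ψ)
      λ v → imp6-modusPonens (⟦ ⋀ fromΨ ⟧₆ v) (⟦ φ ⟧₆ v)

data IsBoolean : V6 → Set where
  f̂-boolean : IsBoolean f̂
  t̂-boolean : IsBoolean t̂

meet6-boolean : ∀ {x y} → IsBoolean x → IsBoolean y → IsBoolean (meet6 x y)
meet6-boolean f̂-boolean _         = f̂-boolean
meet6-boolean t̂-boolean f̂-boolean = f̂-boolean
meet6-boolean t̂-boolean t̂-boolean = t̂-boolean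

join6-boolean : ∀ {x y} → IsBoolean x → IsBoolean y → IsBoolean (join6 x y)
join6-boolean f̂-boolean f̂-boolean = f̂-boolean
join6-boolean f̂-boolean t̂-boolean = t̂-boolean
join6-boolean t̂-boolean f̂-boolean = t̂-boolean
join6-boolean t̂-boolean t̂-boolean = t̂-boolean

imp6-boolean : ∀ {x y} → IsBoolean x → IsBoolean y → IsBoolean (imp6 x y)
imp6-boolean f̂-boolean _         = t̂-boolean
imp6-boolean t̂-boolean f̂-boolean = f̂-boolean
imp6-boolean t̂-boolean t̂-boolean = t̂-boolean

neg6-boolean : ∀ {x} → IsBoolean x → IsBoolean (neg6 x)
neg6-boolean f̂-boolean = t̂-boolean
neg6-boolean t̂-boolean = f̂-boolean

circ6-boolean : ∀ {x} → IsBoolean x → IsBoolean (circ6 x)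
circ6-boolean f̂-boolean = t̂-boolean
circ6-boolean t̂-boolean = t̂-boolean

eval-boolean : ∀ v φ → (∀ p → Occurs p φ → IsBoolean (v p)) → IsBoolean (⟦ φ ⟧₆ v)
eval-boolean v (var p) vars = vars p o-var
eval-boolean v (φ ∧̇ ψ) vars = meet6-boolean (eval-boolean v φ (λ p → vars p ∘ o-∧l)) (eval-boolean v ψ (λ p → vars p ∘ o-∧r))
eval-boolean v (φ ∨̇ ψ) vars = join6-boolean (eval-boolean v φ (λ p → vars p ∘ o-∨l)) (eval-boolean v ψ (λ p → vars p ∘ o-∨r))
eval-boolean v (φ ⇒̇ ψ) vars = imp6-boolean (eval-boolean v φ (λ p → vars p ∘ o-⇒l)) (eval-boolean v ψ (λ p → vars p ∘ o-⇒r))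
eval-boolean v (∼̇ φ)   vars = neg6-boolean (eval-boolean v φ (λ p → vars p ∘ o-∼))
eval-boolean v (∘̇ φ)   vars = circ6-boolean (eval-boolean v φ (λ p → vars p ∘ o-∘))
eval-boolean v ⊥̇       _    = f̂-boolean
eval-boolean v ⊤̇       _    = t̂-boolean

boolean-above-n : ∀ {x} → IsBoolean x → n ≤₆ x → t̂ ≤₆ x
boolean-above-n t̂-boolean _ = refl

no-interpolant-in-boolean-variables :
  ∀ (v : ℕ → V6) {Φ φ} {S : Pred ℕ 0ℓ} →
  (∀ p → S p → IsBoolean (v p)) →
  (∀ ψ → Φ ψ → n ≤₆ ⟦ ψ ⟧₆ v) →
  ¬ (t̂ ≤₆ ⟦ φ ⟧₆ v) →
  ∀ Π → Π ⊆ L S → (∀ π → Π π → Φ ⊢ π) → ¬ (Π ⊢ φ)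
no-interpolant-in-boolean-variables v S-boolean Φ-above-n φ-below-t̂ Π Π⊆LS Φ⊢Π (Δ , Δ⊆Π , Δ≤φ) =
  φ-below-t̂ (≤₆-trans (⋀-greatest v Δ (All.map Π-top Δ⊆Π)) (Δ≤φ PP6 PP6∈variety v))
  where
    Π-top : ∀ {π} → Π π → t̂ ≤₆ ⟦ π ⟧₆ v
    Π-top {π} π∈Π with Φ⊢Π π π∈Π
    ... | Γ , Γ⊆Φ , Γ≤π = boolean-above-n (eval-boolean v π λ p → S-boolean p ∘ Π⊆LS π∈Π p)
      (≤₆-trans (⋀-greatest v Γ (All.map (Φ-above-n _) Γ⊆Φ)) (Γ≤π PP6 PP6∈variety v))

α : Fm
α = var 0 ∧̇ (var 1 ∧̇ (∼̇ var 1))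

φ₀ : Fm
φ₀ = var 0 ∧̇ (var 2 ∨̇ (var 2 ⇒̇ (∼̇ var 2)))

valuation : V6 → V6 → V6 → ℕ → V6
valuation x _ _ 0 = x
valuation _ y _ 1 = y
valuation _ _ z _ = z

α⊢φ₀ : ⟦ α ⟧ ⊢ φ₀
α⊢φ₀ = PP6-valid⇒⊢ {ψ = φ₀} (α ∷ []) (refl ∷ []) λ v → α≤φ₀ (v 0) (v 1) (v 2)
  where
    α≤φ₀ : ∀ x y z → let v = valuation x y z in ⟦ ⋀ (α ∷ []) ⟧₆ v ≤₆ ⟦ φ₀ ⟧₆ v
    α≤φ₀ = from-yes (∀? λ x → ∀? λ y → ∀? λ z → let v = valuation x y z in
      meet6 (⟦ ⋀ (α ∷ []) ⟧₆ v) (⟦ φ₀ ⟧₆ v) ≟ ⟦ ⋀ (α ∷ []) ⟧₆ v)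

α-φ₀-share-only-var0 : ∀ {p} → Occurs p α → Occurs p φ₀ → p ≡ 0
α-φ₀-share-only-var0 (o-∧l o-var) _ = refl
α-φ₀-share-only-var0 (o-∧r (o-∧l o-var)) (o-∧l ())
α-φ₀-share-only-var0 (o-∧r (o-∧l o-var)) (o-∧r (o-∨l ()))
α-φ₀-share-only-var0 (o-∧r (o-∧l o-var)) (o-∧r (o-∨r (o-⇒l ())))
α-φ₀-share-only-var0 (o-∧r (o-∧l o-var)) (o-∧r (o-∨r (o-⇒r (o-∼ ()))))
α-φ₀-share-only-var0 (o-∧r (o-∧r (o-∼ o-var))) (o-∧l ())
α-φ₀-share-only-var0 (o-∧r (o-∧r (o-∼ o-var))) (o-∧r (o-∨l ()))
α-φ₀-share-only-var0 (o-∧r (o-∧r (o-∼ o-var))) (o-∧r (o-∨r (o-⇒l ())))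
α-φ₀-share-only-var0 (o-∧r (o-∧r (o-∼ o-var))) (o-∧r (o-∨r (o-⇒r (o-∼ ()))))

¬cip-⊢ : ¬ CIP _⊢_
¬cip-⊢ cip with cip ⟦ α ⟧ φ₀ (0 , (α , refl , o-∧l o-var) , o-∧l o-var) α⊢φ₀
... | Π , Π⊆L , α⊢Π , Π⊢φ₀ =
  no-interpolant-in-boolean-variables (valuation t̂ n t) {φ = φ₀} shared-boolean (λ { _ refl → refl }) (λ ()) Π Π⊆L α⊢Π Π⊢φ₀
  where
    shared-boolean : ∀ p → (props ⟦ α ⟧ ∩ propsF φ₀) p → IsBoolean (valuation t̂ n t p)
    shared-boolean p ((_ , refl , p∈α) , p∈φ₀) with α-φ₀-share-only-var0 p∈α p∈φ₀
    ... | refl = t̂-boolean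

Monotone : Logic → Set₁
Monotone _⊩_ = ∀ {Φ Φ'} → Φ ⊆ Φ' → ∀ φ → Φ ⊩ φ → Φ' ⊩ φ

⊢-monotone : Monotone _⊢_
⊢-monotone Φ⊆Φ' _ (Δ , Δ⊆Φ , Δ≤φ) = Δ , All.map Φ⊆Φ' Δ⊆Φ , Δ≤φ

mip⇒cip : ∀ {_⊩_} → Monotone _⊩_ → MIP _⊩_ → CIP _⊩_
mip⇒cip mono mip Φ φ (p , p∈Φ , p∈φ) Φ⊩φ
  with mip Φ (λ _ → ⊥) φ (p , p∈Φ , φ , inj₂ refl , p∈φ) (mono inj₁ φ Φ⊩φ)
... | Π , Π⊆L , Φ⊩Π , Π⊩φ = Π , shared-vars , Φ⊩Π , mono [ id , ⊥-elim ] φ Π⊩φ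
  where
    shared-vars : Π ⊆ L (props Φ ∩ propsF φ)
    shared-vars π∈Π q q∈π with Π⊆L π∈Π q q∈π
    ... | q∈Φ , (_ , inj₂ refl , q∈φ) = q∈Φ , q∈φ

¬mip-⊢ : ¬ MIP _⊢_
¬mip-⊢ = ¬cip-⊢ ∘ mip⇒cip ⊢-monotone

theorem8p2 : EIP _⊢_ × ¬ CIP _⊢_ × ¬ MIP _⊢_
theorem8p2 = eip-⊢ , ¬cip-⊢ , ¬mip-⊢
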